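{- Let $n\ge 2$ be an integer such that the zero-divisor graph $\Gamma(\mathbb{Z}_n)$ is a Hamiltonian graph. Then $\gamma_R(\Gamma(\mathbb{Z}_n))=2$.
   Context: For a commutative ring $R$ with unity, $Z(R)$ denotes its set of zero-divisors and the zero-divisor graph $\Gamma(R)$ is the simple undirected graph with vertex set $Z(R)\setminus\{0\}$, in which distinct vertices $x,y$ are adjacent if and only if $xy=0$. A graph is Hamiltonian if it has a cycle passing through every vertex exactly once. For a graph $G=(V,E)$, a Roman dominating function is a map $f:V\to\{0,1,2\}$ such that every vertex $u$ with $f(u)=0$ is adjacent to at least one vertex $v$ with $f(v)=2$; its weight is $\sum_{u\in V} f(u)$, and the Roman domination number $\gamma_R(G)$ is the minimum weight of a Roman dominating function on $G$. -}

module Defs where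

open import Data.Nat using (ℕ; zero; suc; _*_; _%_; _≤_; NonZero)
open import Data.Nat.Properties using (_≟_)
open import Data.Fin using (Fin; toℕ; fromℕ<) renaming (zero to fzero; suc to fsuc)
import Data.Fin.Properties as FinP
open import Data.Fin.Properties using (any?)
open import Data.List using (List; filter; map; allFin)
open import Data.Nat.ListAction using (sum)
open import Data.List.Membership.Propositional using (_∈_)
open import Data.Product using (Σ; ∃; _×_; _,_)
open import Relation.Nullary using (¬_; Dec)
open import Relation.Nullary.Decidable using (_×-dec_; ¬?)
open import Relation.Binary.PropositionalEquality using (_≡_; _≢_)
open import Function.Definitions using (Injective)

-- The ring ℤ_n is represented by Fin n = {0,…,n-1}; multiplication is
-- (x * y) mod n, and the zero element is the residue 0.

module _ (n : ℕ) .{{_ : NonZero n}} where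

  MulZero : Fin n → Fin n → Set
  MulZero x y = (toℕ x * toℕ y) % n ≡ 0

  NonZeroElt : Fin n → Set
  NonZeroElt x = ¬ (toℕ x ≡ 0)

  IsVertex : Fin n → Set
  IsVertex x = NonZeroElt x × ∃ λ (y : Fin n) → NonZeroElt y × MulZero x y

  isVertex? : (x : Fin n) → Dec (IsVertex x)
  isVertex? x = ¬? (toℕ x ≟ 0) ×-dec any? (λ y → ¬? (toℕ y ≟ 0) ×-dec ((toℕ x * toℕ y) % n ≟ 0))

  vertices : List (Fin n)
  vertices = filter isVertex? (allFin n)

  Adj : Fin n → Fin n → Set
  Adj x y = IsVertex x × IsVertex y × x ≢ y × MulZero x y

  Hamiltonian : Set
  Hamiltonian =
    Σ ℕ λ k → Σ (3 ≤ k) λ _ → Σ (Fin k → Fin n) λ v →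
      Injective _≡_ _≡_ v
      × ((i : Fin k) → IsVertex (v i))
      × ((x : Fin n) → IsVertex x → ∃ λ i → v i ≡ x)
      × ((i : Fin k) → Adj (v i) (v (next k i)))
    where
    next : (k : ℕ) → Fin k → Fin k
    next (suc k) i = fromℕ< {(suc (toℕ i)) % suc k} (Data.Nat.DivMod.m%n<n (suc (toℕ i)) (suc k))
      where import Data.Nat.DivMod

  -- Roman dominating function on Γ(ℤ_n) (values on non-vertices are ignored)
  IsRDF : (Fin n → ℕ) → Set
  IsRDF f =
    ((x : Fin n) → IsVertex x → f x ≤ 2)
    × ((x : Fin n) → IsVertex x → f x ≡ 0 → ∃ λ y → Adj x y × f y ≡ 2)

  weight : (Fin n → ℕ) → ℕ
  weight f = sum (map f vertices)

  RomanDominationNumberIs : ℕ → Set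
  RomanDominationNumberIs m =
    (Σ (Fin n → ℕ) λ f → IsRDF f × weight f ≡ m)
    × ((f : Fin n → ℕ) → IsRDF f → m ≤ weight f)

module Submission where

-- Let p be the least prime factor of n and n = r p. If some vertex y were not divisible by p, then
-- p < r, and the p vertices u p with u ∈ {r - 1, 1, …, p - 1}, all coprime to r, would have all their
-- neighbours among the p - 1 nonzero multiples of r; but successors on a Hamiltonian cycle give an
-- injective choice of neighbours. So p divides every vertex, and then r is adjacent to every other
-- vertex: putting 2 on r and 0 elsewhere is a Roman dominating function of weight 2, while every
-- Roman dominating function on a graph with an edge has weight at least 2.

open import Defs

open import Data.Fin using (Fin; toℕ; fromℕ<) renaming (zero to fzero; suc to fsuc)
open import Data.Fin.Properties using (_≟_; injective⇒≤; toℕ-injective; toℕ<n; toℕ-fromℕ<)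
open import Data.List using (_∷_; map)
open import Data.List.Membership.Propositional using (_∈_)
open import Data.List.Membership.Propositional.Properties using (∈-filter⁺; ∈-allFin)
open import Data.List.Relation.Unary.All using (All; []; _∷_)
import Data.List.Relation.Unary.All as All
open import Data.List.Relation.Unary.Any using (here; there)
open import Data.List.Relation.Unary.Unique.Propositional using (Unique; _∷_)
import Data.List.Relation.Unary.Unique.Propositional.Properties as Unique
open import Data.Nat
  using (ℕ; zero; suc; 2+; _+_; _*_; _∸_; _%_; _≤_; _<_; z≤n; z<s; s≤s; s≤s⁻¹;
         NonZero; ≢-nonZero; ≢-nonZero⁻¹; nonTrivial⇒n>1)
open import Data.Nat.Coprimality using (Coprime; coprime-+; 1-coprimeTo; coprime-divisor)
import Data.Nat.Coprimality as Coprime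
open import Data.Nat.Divisibility
  using (_∣_; _∣?_; divides; ∣-refl; ∣-trans; 1∣_; 0∣⇒≡0; ∣⇒≤; m%n≡0⇒n∣m; n∣m⇒m%n≡0;
         *-monoˡ-∣; *-cancelʳ-∣)
open import Data.Nat.Divisibility.Core using (hasNonTrivialDivisor)
open import Data.Nat.DivMod using (m<n⇒m%n≡m; n%n≡0; m%n<n)
open import Data.Nat.ListAction using (sum)
open import Data.Nat.Primality
  using (Prime; prime⇒nonZero; prime⇒nonTrivial; euclidsLemma; _Rough_; 2-rough; ∤⇒rough-suc;
         rough∧∣⇒prime)
open import Data.Nat.Properties
  using (≤-refl; ≤-trans; <-trans; ≤-<-trans; <-≤-trans; <⇒≢; <⇒≱; ≮⇒≥; 1+n≰n; n<1+n;
         m≤n⇒m<n∨m≡n; m≤m+n; m≤n+m; suc-injective; +-comm; +-suc; +-identityʳ; m+[n∸m]≡n;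
         +-mono-≤; +-monoʳ-≤; *-comm; *-assoc; *-cancelʳ-≡; *-cancelʳ-<; *-monoˡ-<; m<m*n;
         m*n≡0⇒m≡0; module ≤-Reasoning)
open import Data.Product using (∃-syntax; _×_; _,_; proj₁; proj₂)
open import Data.Sum using (_⊎_; inj₁; inj₂; [_,_]′)
open import Function using (flip)
open import Function.Definitions using (Injective)
open import Relation.Binary.PropositionalEquality
  using (_≡_; _≢_; refl; sym; trans; cong; cong₂; subst; subst₂; module ≡-Reasoning)
open import Relation.Nullary using (¬_; yes; no; contradiction)

module _ {A : Set} (f : A → ℕ) where

  ∈⇒≤sum-map : ∀ {x xs} → x ∈ xs → f x ≤ sum (map f xs)
  ∈⇒≤sum-map (here refl) = m≤m+n _ _
  ∈⇒≤sum-map {xs = y ∷ _} (there x∈xs) = ≤-trans (∈⇒≤sum-map x∈xs) (m≤n+m _ (f y))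

  ∈∧∈⇒+≤sum-map : ∀ {x y xs} → x ≢ y → x ∈ xs → y ∈ xs → f x + f y ≤ sum (map f xs)
  ∈∧∈⇒+≤sum-map x≢y (here refl) (here refl) with () ← x≢y refl
  ∈∧∈⇒+≤sum-map x≢y (here refl) (there y∈xs) = +-monoʳ-≤ _ (∈⇒≤sum-map y∈xs)
  ∈∧∈⇒+≤sum-map {x} {y} {_ ∷ xs} x≢y (there x∈xs) (here refl) =
    subst (_≤ f y + sum (map f xs)) (+-comm (f y) (f x)) (+-monoʳ-≤ _ (∈⇒≤sum-map x∈xs))
  ∈∧∈⇒+≤sum-map {xs = z ∷ _} x≢y (there x∈xs) (there y∈xs) =
    ≤-trans (∈∧∈⇒+≤sum-map x≢y x∈xs y∈xs) (m≤n+m _ (f z))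

  sum-map-≡0 : ∀ {xs} → All (λ x → f x ≡ 0) xs → sum (map f xs) ≡ 0
  sum-map-≡0 [] = refl
  sum-map-≡0 (fx≡0 ∷ fxs≡0) rewrite fx≡0 = sum-map-≡0 fxs≡0

  sum-map-supported : ∀ {a xs} → Unique xs → a ∈ xs → (∀ x → x ≢ a → f x ≡ 0) → sum (map f xs) ≡ f a
  sum-map-supported (a≢xs ∷ _) (here refl) off-a =
    trans (cong (f _ +_) (sum-map-≡0 (All.map (λ a≢x → off-a _ (λ x≡a → a≢x (sym x≡a))) a≢xs)))
          (+-identityʳ _)
  sum-map-supported (x≢xs ∷ uniq) (there a∈xs) off-a rewrite off-a _ (All.lookup x≢xs a∈xs) =
    sum-map-supported uniq a∈xs off-a

leastPrimeDivisor : ∀ {n} → 2 ≤ n → ∃[ p ] Prime p × p ∣ n × p Rough n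
leastPrimeDivisor {n} 2≤n = search 0 (n ∸ 2) (m+[n∸m]≡n 2≤n) 2-rough
  where
  search : ∀ m k → 2 + m + k ≡ n → (2 + m) Rough n → ∃[ p ] Prime p × p ∣ n × p Rough n
  search m k _ rough with 2 + m ∣? n
  ... | yes m∣n = 2 + m , rough∧∣⇒prime rough m∣n , m∣n , rough
  search m zero m+0≡n _ | no m∤n =
    contradiction (subst (2 + m ∣_) (trans (sym (+-identityʳ _)) m+0≡n) ∣-refl) m∤n
  search m (suc k) m+1+k≡n rough | no m∤n =
    search (suc m) k (trans (sym (+-suc (2 + m) k)) m+1+k≡n) (∤⇒rough-suc m∤n rough)

prime⇒1<p : ∀ {p} → Prime p → 1 < p
prime⇒1<p {p} p-prime = nonTrivial⇒n>1 p {{prime⇒nonTrivial p-prime}}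

rough∧∣⇒≡1⊎≥ : ∀ {p n d} .{{_ : NonZero n}} → p Rough n → d ∣ n → d ≡ 1 ⊎ p ≤ d
rough∧∣⇒≡1⊎≥ {d = zero} _ 0∣n with () ← ≢-nonZero⁻¹ _ (0∣⇒≡0 0∣n)
rough∧∣⇒≡1⊎≥ {d = 1} _ _ = inj₁ refl
rough∧∣⇒≡1⊎≥ {d = 2+ _} rough d∣n = inj₂ (≮⇒≥ (λ d<p → rough (hasNonTrivialDivisor d<p d∣n)))

rough∧∣⇒coprime : ∀ {p n d u} .{{_ : NonZero n}} → p Rough n → d ∣ n → 0 < u → u < p → Coprime u d
rough∧∣⇒coprime {u = suc _} rough d∣n _ u<p {i} (i∣u , i∣d) with rough∧∣⇒≡1⊎≥ rough (∣-trans i∣d d∣n)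
... | inj₁ i≡1 = i≡1
... | inj₂ p≤i with () ← <⇒≱ (≤-<-trans (∣⇒≤ i∣u) u<p) p≤i

suc-coprime : ∀ m → Coprime (suc m) m
suc-coprime m = subst (λ k → Coprime k m) (+-comm m 1) (coprime-+ (1-coprimeTo m))

suc-mod-injective : ∀ {m a b} .{{_ : NonZero m}} → a < m → b < m → suc a % m ≡ suc b % m → a ≡ b
suc-mod-injective {m} {a} {b} a<m b<m eq with m≤n⇒m<n∨m≡n a<m | m≤n⇒m<n∨m≡n b<m
... | inj₁ 1+a<m | inj₁ 1+b<m =
  suc-injective (trans (sym (m<n⇒m%n≡m 1+a<m)) (trans eq (m<n⇒m%n≡m 1+b<m)))
... | inj₂ refl | inj₂ 1+b≡m = suc-injective (sym 1+b≡m)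
... | inj₁ 1+a<m | inj₂ refl with () ← trans (sym (m<n⇒m%n≡m 1+a<m)) (trans eq (n%n≡0 m))
... | inj₂ refl | inj₁ 1+b<m with () ← trans (sym (n%n≡0 m)) (trans eq (m<n⇒m%n≡m 1+b<m))

-- Must stay definitionally equal to the successor used in the definition of Hamiltonian.
next : ∀ k → Fin k → Fin k
next (suc k) i = fromℕ< (m%n<n (suc (toℕ i)) (suc k))

next-injective : ∀ {k} → Injective _≡_ _≡_ (next k)
next-injective {suc k} {i} {j} eq = toℕ-injective (suc-mod-injective (toℕ<n i) (toℕ<n j) (begin
  suc (toℕ i) % suc k  ≡⟨ toℕ-fromℕ< _ ⟨
  toℕ (next (suc k) i) ≡⟨ cong toℕ eq ⟩
  toℕ (next (suc k) j) ≡⟨ toℕ-fromℕ< _ ⟩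
  suc (toℕ j) % suc k  ∎))
  where open ≡-Reasoning

module _ {n : ℕ} .{{_ : NonZero n}} where

  hamiltonian⇒edge : Hamiltonian n → ∃[ x ] ∃[ y ] Adj n x y
  hamiltonian⇒edge (suc k , _ , v , _ , _ , _ , cycle) = v fzero , v (next (suc k) fzero) , cycle fzero

  hamiltonian⇒neighbourInjection : Hamiltonian n → ∀ {t} (I : Fin t → Fin n) → Injective _≡_ _≡_ I →
    (∀ j → IsVertex n (I j)) → ∃[ J ] Injective _≡_ _≡_ J × (∀ j → Adj n (I j) (J j))
  hamiltonian⇒neighbourInjection (suc k , _ , v , v-injective , _ , covers , cycle)
    I I-injective I-vertex = J , J-injective , I-adj-J
    where
    position : ∀ j → ∃[ i ] v i ≡ I j
    position j = covers (I j) (I-vertex j)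
    J : _ → Fin n
    J j = v (next (suc k) (proj₁ (position j)))
    J-injective : Injective _≡_ _≡_ J
    J-injective {j₁} {j₂} eq = I-injective (begin
      I j₁                         ≡⟨ proj₂ (position j₁) ⟨
      v (proj₁ (position j₁))      ≡⟨ cong v (next-injective (v-injective eq)) ⟩
      v (proj₁ (position j₂))      ≡⟨ proj₂ (position j₂) ⟩
      I j₂                         ∎)
      where open ≡-Reasoning
    I-adj-J : ∀ j → Adj n (I j) (J j)
    I-adj-J j = subst (λ x → Adj n x (J j)) (proj₂ (position j)) (cycle (proj₁ (position j)))

  vertex∈vertices : ∀ {x} → IsVertex n x → x ∈ vertices n
  vertex∈vertices {x} = ∈-filter⁺ (isVertex? n) (∈-allFin x)

  vertices-unique : Unique (vertices n)
  vertices-unique = Unique.filter⁺ (isVertex? n) (Unique.allFin⁺ n)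

  vertex⇒≤weight : ∀ {x} f → IsVertex n x → f x ≤ weight n f
  vertex⇒≤weight f x-vertex = ∈⇒≤sum-map f (vertex∈vertices x-vertex)

  adj⇒2≤weight : ∀ {a b f} → Adj n a b → IsRDF n f → 2 ≤ weight n f
  adj⇒2≤weight {a} {b} {f} (a-vertex , b-vertex , a≢b , _) (_ , dominated) with f a in fa | f b in fb
  ... | zero  | _     = let (y , (_ , y-vertex , _) , fy≡2) = dominated a a-vertex fa in
                        subst (_≤ weight n f) fy≡2 (vertex⇒≤weight f y-vertex)
  ... | suc _ | zero  = let (y , (_ , y-vertex , _) , fy≡2) = dominated b b-vertex fb in
                        subst (_≤ weight n f) fy≡2 (vertex⇒≤weight f y-vertex)
  ... | suc x | suc y = begin
    2              ≤⟨ +-mono-≤ (s≤s z≤n) (s≤s z≤n) ⟩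
    suc x + suc y  ≡⟨ cong₂ _+_ fa fb ⟨
    f a + f b      ≤⟨ ∈∧∈⇒+≤sum-map f a≢b (vertex∈vertices a-vertex) (vertex∈vertices b-vertex) ⟩
    weight n f     ∎
    where open ≤-Reasoning

  universalVertex⇒romanDomination≡2 : ∀ {a b} c → IsVertex n c →
    (∀ x → IsVertex n x → x ≢ c → MulZero n x c) → Adj n a b → RomanDominationNumberIs n 2
  universalVertex⇒romanDomination≡2 c c-vertex universal ab =
    (f , (f≤2 , f-dominating) , weight≡2) , λ _ → adj⇒2≤weight ab
    where
    f : Fin n → ℕ
    f x with x ≟ c
    ... | yes _ = 2
    ... | no  _ = 0
    f≤2 : ∀ x → IsVertex n x → f x ≤ 2
    f≤2 x _ with x ≟ c
    ... | yes _ = ≤-refl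
    ... | no  _ = z≤n
    fc≡2 : f c ≡ 2
    fc≡2 with c ≟ c
    ... | yes _   = refl
    ... | no  c≢c with () ← c≢c refl
    f-off-c : ∀ x → x ≢ c → f x ≡ 0
    f-off-c x x≢c with x ≟ c
    ... | yes x≡c with () ← x≢c x≡c
    ... | no  _   = refl
    f-dominating : ∀ x → IsVertex n x → f x ≡ 0 → ∃[ y ] Adj n x y × f y ≡ 2
    f-dominating x x-vertex fx≡0 = c , (x-vertex , c-vertex , x≢c , universal x x-vertex x≢c) , fc≡2
      where
      x≢c : x ≢ c
      x≢c refl with () ← trans (sym fx≡0) fc≡2
    weight≡2 : weight n f ≡ 2
    weight≡2 = trans (sum-map-supported f vertices-unique (vertex∈vertices c-vertex) f-off-c) fc≡2

  mulZero⇒∣ : ∀ x y → MulZero n x y → n ∣ toℕ x * toℕ y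
  mulZero⇒∣ x y = m%n≡0⇒n∣m _ n

  ∣⇒mulZero : ∀ x y → n ∣ toℕ x * toℕ y → MulZero n x y
  ∣⇒mulZero x y = n∣m⇒m%n≡0 _ n

  mulZero-comm : ∀ x y → MulZero n x y → MulZero n y x
  mulZero-comm x y = subst (λ m → m % n ≡ 0) (*-comm (toℕ x) (toℕ y))

  nonZeroElt⇒¬n∣ : ∀ {x} → NonZeroElt n x → ¬ n ∣ toℕ x
  nonZeroElt⇒¬n∣ {x} x≢0 n∣x = <⇒≱ (toℕ<n x) (∣⇒≤ {{≢-nonZero x≢0}} n∣x)

  module _ (p r : ℕ) (n≡rp : n ≡ r * p) where

    cofactor≢0 : r ≢ 0
    cofactor≢0 refl = ≢-nonZero⁻¹ n n≡rp

    cofactor : 1 < p → ∃[ c ] NonZeroElt n c × toℕ c ≡ r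
    cofactor 1<p = fromℕ< r<n , (λ c≡0 → cofactor≢0 (trans (sym c≡r) c≡0)) , c≡r
      where
      instance
        r-nonZero : NonZero r
        r-nonZero = ≢-nonZero cofactor≢0
      r<n : r < n
      r<n = subst (r <_) (sym n≡rp) (m<m*n r p 1<p)
      c≡r : toℕ (fromℕ< r<n) ≡ r
      c≡r = toℕ-fromℕ< r<n

    multiple⇒mulZero-cofactor : ∀ x c → p ∣ toℕ x → toℕ c ≡ r → MulZero n x c
    multiple⇒mulZero-cofactor x c p∣x c≡r = ∣⇒mulZero x c
      (subst₂ _∣_ (trans (*-comm p r) (sym n≡rp)) (cong (toℕ x *_) (sym c≡r)) (*-monoˡ-∣ r p∣x))

    nonZeroMultiple⇒vertex : ∀ x → 1 < p → NonZeroElt n x → p ∣ toℕ x → IsVertex n x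
    nonZeroMultiple⇒vertex x 1<p x≢0 p∣x =
      let (c , c≢0 , c≡r) = cofactor 1<p in
      x≢0 , c , c≢0 , multiple⇒mulZero-cofactor x c p∣x c≡r

    divisibleVertices⇒universalVertex : ∀ {a} → 1 < p → (∀ x → IsVertex n x → p ∣ toℕ x) →
      IsVertex n a → ∃[ c ] IsVertex n c × (∀ x → IsVertex n x → x ≢ c → MulZero n x c)
    divisibleVertices⇒universalVertex {a} 1<p p∣vertices a-vertex =
      let (c , c≢0 , c≡r) = cofactor 1<p
          c-annihilates x x-vertex = multiple⇒mulZero-cofactor x c (p∣vertices x x-vertex) c≡r
      in c , (c≢0 , a , proj₁ a-vertex , mulZero-comm a c (c-annihilates a a-vertex)) ,
         λ x x-vertex _ → c-annihilates x x-vertex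

    leastPrime<cofactor : Prime p → p Rough n → ∀ y → IsVertex n y → ¬ p ∣ toℕ y → p < r
    leastPrime<cofactor p-prime rough y (_ , z , z≢0 , yz≡0) p∤y = cofactor-bound p∣z
      where
      instance
        p-nonZero : NonZero p
        p-nonZero = prime⇒nonZero p-prime
      n∣yz : n ∣ toℕ y * toℕ z
      n∣yz = mulZero⇒∣ y z yz≡0
      p∣z : p ∣ toℕ z
      p∣z with euclidsLemma (toℕ y) (toℕ z) p-prime (∣-trans (divides r n≡rp) n∣yz)
      ... | inj₁ p∣y = contradiction p∣y p∤y
      ... | inj₂ p∣z = p∣z
      -- With z = w p, the relation n ∣ y z becomes r ∣ y w, while r ∣ w would force n ∣ z.
      r∣yw : ∀ {w} → toℕ z ≡ w * p → r ∣ toℕ y * w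
      r∣yw {w} z≡wp = *-cancelʳ-∣ p (subst₂ _∣_ n≡rp
        (trans (cong (toℕ y *_) z≡wp) (sym (*-assoc (toℕ y) w p))) n∣yz)
      r∤w : ∀ {w} → toℕ z ≡ w * p → ¬ r ∣ w
      r∤w z≡wp r∣w = nonZeroElt⇒¬n∣ z≢0 (subst₂ _∣_ (sym n≡rp) (sym z≡wp) (*-monoˡ-∣ p r∣w))
      cofactor-bound : p ∣ toℕ z → p < r
      cofactor-bound (divides w z≡wp) with rough∧∣⇒≡1⊎≥ rough (divides p (trans n≡rp (*-comm r p)))
      ... | inj₁ refl = contradiction (1∣ w) (r∤w z≡wp)
      ... | inj₂ p≤r with m≤n⇒m<n∨m≡n p≤r
      ...   | inj₁ p<r = p<r
      ...   | inj₂ refl = [ flip contradiction p∤y , flip contradiction (r∤w z≡wp) ]′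
                            (euclidsLemma (toℕ y) w p-prime (r∣yw z≡wp))

    coprimeMultiple-mulZero⇒cofactor∣ : .{{_ : NonZero p}} → ∀ {u} x y → Coprime r u → toℕ x ≡ u * p →
      MulZero n x y → r ∣ toℕ y
    coprimeMultiple-mulZero⇒cofactor∣ {u} x y r⊥u x≡up xy≡0 =
      coprime-divisor r⊥u (*-cancelʳ-∣ p (subst₂ _∣_ n≡rp xy≡uyp (mulZero⇒∣ x y xy≡0)))
      where
      open ≡-Reasoning
      xy≡uyp : toℕ x * toℕ y ≡ u * toℕ y * p
      xy≡uyp = begin
        toℕ x * toℕ y     ≡⟨ cong (_* toℕ y) x≡up ⟩
        u * p * toℕ y     ≡⟨ *-assoc u p (toℕ y) ⟩
        u * (p * toℕ y)   ≡⟨ cong (u *_) (*-comm p (toℕ y)) ⟩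
        u * (toℕ y * p)   ≡⟨ *-assoc u (toℕ y) p ⟨
        u * toℕ y * p     ∎

  nonZeroMultiples-injection⇒≤ : ∀ {t} p r → n ≡ r * suc p → (J : Fin t → Fin n) → Injective _≡_ _≡_ J →
    (∀ j → NonZeroElt n (J j)) → (∀ j → r ∣ toℕ (J j)) → t ≤ p
  nonZeroMultiples-injection⇒≤ p r n≡rp J J-injective J≢0 r∣J = injective⇒≤ code-injective
    where
    quotient : ∀ x → NonZeroElt n x → r ∣ toℕ x → ∃[ c ] toℕ x ≡ suc (toℕ {p} c) * r
    quotient x x≢0 (divides zero x≡0) = contradiction x≡0 x≢0
    quotient x x≢0 (divides (suc c) x≡cr) =
      fromℕ< c<p , trans x≡cr (cong (λ k → suc k * r) (sym (toℕ-fromℕ< c<p)))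
      where
      c<p : c < p
      c<p = s≤s⁻¹ (*-cancelʳ-< r (suc c) (suc p)
        (subst₂ _<_ x≡cr (trans n≡rp (*-comm r (suc p))) (toℕ<n x)))
    code : _ → Fin p
    code j = proj₁ (quotient (J j) (J≢0 j) (r∣J j))
    code-injective : Injective _≡_ _≡_ code
    code-injective {j₁} {j₂} eq = J-injective (toℕ-injective (begin
      toℕ (J j₁)              ≡⟨ proj₂ (quotient (J j₁) (J≢0 j₁) (r∣J j₁)) ⟩
      suc (toℕ (code j₁)) * r ≡⟨ cong (λ c → suc (toℕ c) * r) eq ⟩
      suc (toℕ (code j₂)) * r ≡⟨ proj₂ (quotient (J j₂) (J≢0 j₂) (r∣J j₂)) ⟨
      toℕ (J j₂)              ∎))
      where open ≡-Reasoning

  leastPrime<cofactor⇒¬hamiltonian : ∀ p r → n ≡ r * p → p Rough n → 1 < p → p < r → ¬ Hamiltonian n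
  leastPrime<cofactor⇒¬hamiltonian (suc p) (suc r) n≡rp rough 1<p p<r ham =
    1+n≰n (nonZeroMultiples-injection⇒≤ p (suc r) n≡rp J J-injective J≢0 r∣J)
    where
    unit : Fin (suc p) → ℕ
    unit fzero    = r
    unit (fsuc j) = suc (toℕ j)

    1+j<r : ∀ (j : Fin p) → suc (toℕ j) < r
    1+j<r j = <-≤-trans (s≤s (toℕ<n j)) (s≤s⁻¹ p<r)

    unit-coprime : ∀ j → Coprime (suc r) (unit j)
    unit-coprime fzero    = suc-coprime r
    unit-coprime (fsuc j) = Coprime.sym
      (rough∧∣⇒coprime rough (divides (suc p) (trans n≡rp (*-comm (suc r) (suc p)))) z<s (s≤s (toℕ<n j)))

    unit<r : ∀ j → unit j < suc r
    unit<r fzero    = n<1+n r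
    unit<r (fsuc j) = <-trans (1+j<r j) (n<1+n r)

    unit≢0 : ∀ j → unit j ≢ 0
    unit≢0 fzero    r≡0 = <⇒≢ (<-≤-trans z<s (s≤s⁻¹ p<r)) (sym r≡0)
    unit≢0 (fsuc j) ()

    unit-injective : Injective _≡_ _≡_ unit
    unit-injective {fzero}  {fzero}  _  = refl
    unit-injective {fzero}  {fsuc j} eq = contradiction (sym eq) (<⇒≢ (1+j<r j))
    unit-injective {fsuc i} {fzero}  eq = contradiction eq (<⇒≢ (1+j<r i))
    unit-injective {fsuc i} {fsuc j} eq = cong fsuc (toℕ-injective (suc-injective eq))

    unit*p<n : ∀ j → unit j * suc p < n
    unit*p<n j = subst (unit j * suc p <_) (sym n≡rp) (*-monoˡ-< (suc p) (unit<r j))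

    I : Fin (suc p) → Fin n
    I j = fromℕ< (unit*p<n j)

    I≡unit*p : ∀ j → toℕ (I j) ≡ unit j * suc p
    I≡unit*p j = toℕ-fromℕ< (unit*p<n j)

    I-injective : Injective _≡_ _≡_ I
    I-injective {i} {j} eq = unit-injective (*-cancelʳ-≡ (unit i) (unit j) (suc p)
      (trans (sym (I≡unit*p i)) (trans (cong toℕ eq) (I≡unit*p j))))

    I-vertex : ∀ j → IsVertex n (I j)
    I-vertex j = nonZeroMultiple⇒vertex (suc p) (suc r) n≡rp (I j) 1<p
      (λ I≡0 → unit≢0 j (m*n≡0⇒m≡0 (unit j) (suc p) (trans (sym (I≡unit*p j)) I≡0)))
      (divides (unit j) (I≡unit*p j))

    neighbours : ∃[ J ] Injective _≡_ _≡_ J × (∀ j → Adj n (I j) (J j))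
    neighbours = hamiltonian⇒neighbourInjection ham I I-injective I-vertex

    J : Fin (suc p) → Fin n
    J = proj₁ neighbours

    J-injective : Injective _≡_ _≡_ J
    J-injective = proj₁ (proj₂ neighbours)

    I-adj-J : ∀ j → Adj n (I j) (J j)
    I-adj-J = proj₂ (proj₂ neighbours)

    J≢0 : ∀ j → NonZeroElt n (J j)
    J≢0 j = proj₁ (proj₁ (proj₂ (I-adj-J j)))

    r∣J : ∀ j → suc r ∣ toℕ (J j)
    r∣J j = coprimeMultiple-mulZero⇒cofactor∣ (suc p) (suc r) n≡rp (I j) (J j)
      (unit-coprime j) (I≡unit*p j) (proj₂ (proj₂ (proj₂ (I-adj-J j))))

  leastPrime∣vertices : ∀ p r → n ≡ r * p → Prime p → p Rough n → Hamiltonian n →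
    ∀ x → IsVertex n x → p ∣ toℕ x
  leastPrime∣vertices p r n≡rp p-prime rough ham x x-vertex with p ∣? toℕ x
  ... | yes p∣x = p∣x
  ... | no  p∤x = contradiction ham (leastPrime<cofactor⇒¬hamiltonian p r n≡rp rough (prime⇒1<p p-prime)
                    (leastPrime<cofactor p r n≡rp p-prime rough x x-vertex p∤x))

corollary3p2 : (n : ℕ) .{{_ : NonZero n}} → 2 ≤ n → Hamiltonian n → RomanDominationNumberIs n 2
corollary3p2 n 2≤n ham with leastPrimeDivisor 2≤n | hamiltonian⇒edge ham
... | p , p-prime , divides r n≡rp , rough | a , b , ab =
  let (c , c-vertex , c-universal) = divisibleVertices⇒universalVertex p r n≡rp (prime⇒1<p p-prime)
        (leastPrime∣vertices p r n≡rp p-prime rough ham) (proj₁ ab)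
  in universalVertex⇒romanDomination≡2 c c-vertex c-universal ab
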